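{- Consider words over the alphabet $\{\mathsf x,\mathsf y\}$. A history of length $n$ is a sequence $w_0=\mathsf x,w_1,\dots,w_n$ together with, for each $j<n$, a choice of a position in $w_j$, such that $w_{j+1}$ is obtained from $w_j$ by replacing the letter at the chosen position by $\mathsf y\mathsf y$ if it is $\mathsf x$ and by $\mathsf x\mathsf x$ if it is $\mathsf y$ (so there are exactly $n!$ histories of length $n$, and $w_n$ has $n+1$ letters). Let $H_{n,k}$ be the number of histories of length $n$ whose final word $w_n$ contains exactly $k$ occurrences of $\mathsf x$. Let $\operatorname{sm},\operatorname{cm}$ be the functions analytic near $0$ with $\operatorname{sm}'=\operatorname{cm}^2$, $\operatorname{cm}'=-\operatorname{sm}^2$, $\operatorname{sm}(0)=0$, $\operatorname{cm}(0)=1$, and set $\operatorname{smh}(z)=-\operatorname{sm}(-z)$, $\operatorname{cmh}(z)=\operatorname{cm}(-z)$. Then $$\sum_{n\ge0}H_{n,0}\frac{z^n}{n!}=\operatorname{smh}(z)=\frac{\operatorname{sm}(z)}{\operatorname{cm}(z)}=-\operatorname{sm}(-z),\qquad \sum_{n\ge0}H_{n,n+1}\frac{z^n}{n!}=\operatorname{cmh}(z)=\frac{1}{\operatorname{cm}(z)}=\operatorname{cm}(-z).$$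
   Context: This is the P\'olya urn with placement matrix $\begin{pmatrix}-1&2\\2&-1\end{pmatrix}$ started with one ball of type $\mathsf x$: $H_{n,0}$ counts histories ending with all balls of type $\mathsf y$, and $H_{n,n+1}$ those ending with all balls of type $\mathsf x$. Equivalently $\operatorname{smh},\operatorname{cmh}$ solve $x'=y^2$, $y'=x^2$, $x(0)=0$, $y(0)=1$. -}

module Defs where

open import Data.Nat as ℕ using (ℕ; zero; suc; _!; _∸_)
open import Data.Nat.Properties using (_!≢0)
open import Data.Integer using (+_)
open import Data.Rational as ℚ using (ℚ; 0ℚ; 1ℚ; -_; _*_; _+_; _/_)
open import Data.Fin using (Fin; zero; suc; toℕ)
open import Data.List using (List; []; _∷_; length; map; concatMap; _++_; filter; allFin)
open import Data.Product using (Σ; _×_; _,_; proj₁; proj₂)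
open import Relation.Binary.PropositionalEquality using (_≡_)
open import Relation.Nullary using (Dec; yes; no)

data Letter : Set where
  x y : Letter

Word : Set
Word = List Letter

image : Letter → Word
image x = y ∷ y ∷ []
image y = x ∷ x ∷ []

replaceAt : (w : Word) → Fin (length w) → Word
replaceAt (a ∷ w) zero    = image a ++ w
replaceAt (a ∷ w) (suc i) = a ∷ replaceAt w i

countX : Word → ℕ
countX []       = 0
countX (x ∷ w)  = suc (countX w)
countX (y ∷ w)  = countX w

-- Histories.  A history of length n is recorded as its list of steps
-- (w_j , chosen position in w_j) for j < n, together with the final word w_n.

Step : Set
Step = Σ Word (λ w → Fin (length w))

History : Set
History = List Step × Word

histories : ℕ → List History
histories zero    = ([] , x ∷ []) ∷ []
histories (suc n) =
  concatMap (λ h → map (λ p → (proj₁ h ++ ((proj₂ h , p) ∷ []) , replaceAt (proj₂ h) p))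
                       (allFin (length (proj₂ h))))
            (histories n)

H : ℕ → ℕ → ℕ
H n k = length (filter (λ h → countX (proj₂ h) ℕ.≟ k) (histories n))

PS : Set
PS = ℕ → ℚ

sumTo : ℕ → (ℕ → ℚ) → ℚ
sumTo zero    f = f 0
sumTo (suc n) f = sumTo n f + f (suc n)

_⊛_ : PS → PS → PS
(f ⊛ g) n = sumTo n (λ i → f i * g (n ∸ i))

deriv : PS → PS
deriv f n = ((+ suc n) / 1) * f (suc n)

negPS : PS → PS
negPS f n = - f n

reflect : PS → PS
reflect f n = ((Data.Integer.-_ (+ 1)) Data.Integer.^ n / 1) * f n
  where import Data.Integer

onePS : PS
onePS zero    = 1ℚ
onePS (suc n) = 0ℚ

egf : (ℕ → ℕ) → PS
egf a n = _/_ (+ a n) (n !) {{n !≢0}}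

_≐_ : PS → PS → Set
f ≐ g = ∀ n → f n ≡ g n

IsSmCm : PS → PS → Set
IsSmCm sm cm =
  (sm 0 ≡ 0ℚ) × (cm 0 ≡ 1ℚ) × (deriv sm ≐ (cm ⊛ cm)) × (deriv cm ≐ negPS (sm ⊛ sm))

smh : PS → PS
smh sm = negPS (reflect sm)

cmh : PS → PS
cmh cm = reflect cm

-- Splitting a history at its first step shows that the number E n i j of histories starting from
-- a word with i letters x and j letters y satisfies E (n+1) i j = i E n (i−1) (j+2) + j E n (i+2) (j−1),
-- so the exponential generating functions F i j of these numbers satisfy
-- F′ i j = i F (i−1) (j+2) + j F (i+2) (j−1).  If x′ = y² and y′ = x², the products xⁱ yʲ satisfy
-- the same recursion, and a family satisfying it is determined by its constant terms.  Comparing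
-- constant terms identifies the series of H n 0 with x and that of H n (n+1) with y, for the solution
-- (x , y) = (smh , cmh) obtained from (sm , cm) by z ↦ −z.  Since sm³ + cm³ is constant, equal to 1,
-- the pair (sm/cm , 1/cm) solves the same system with the same initial values, so smh = sm/cm and
-- cmh = 1/cm by the same uniqueness.
module Submission where

open import Defs
open import Data.Nat using (suc)
open import Data.Product using (_×_)

open import Data.Nat as ℕ using (ℕ; zero; _∸_; _!)
open import Data.Product using (_,_; proj₁; proj₂)
open import Relation.Binary.PropositionalEquality
  using (_≡_; refl; sym; trans; cong; cong₂; module ≡-Reasoning; ≡-≟-identity; ≢-≟-identity)

-- Counting histories

module Urn where

  open import Data.Nat using (_+_; _*_; _≟_)
  open import Data.Nat.Properties using (+-assoc; +-identityʳ; m+1+n≢m; +-commutativeSemigroup)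
  open import Data.Nat.Tactic.RingSolver using (solve-∀)
  open import Algebra.Properties.CommutativeSemigroup +-commutativeSemigroup using (x∙yz≈y∙xz)
  open import Data.Bool using (if_then_else_; true; false)
  open import Data.List using (List; []; _∷_; [_]; length; map; concatMap; _++_; filter; allFin; tabulate)
  open import Data.Nat.ListAction using (sum)
  open import Data.Nat.ListAction.Properties using (sum-++)
  open import Data.List.Properties
    using (map-tabulate; map-∘; map-cong; map-++; map-concatMap; concatMap-map; concatMap-cong; concatMap-pure; ++-identityʳ)
  open import Data.List.Effectful using (module MonadProperties)
  open import Function using (id; _∘_)
  import Data.Fin as Fin
  open import Relation.Nullary using (does; Dec)

  countY : Word → ℕ
  countY []      = 0
  countY (x ∷ w) = countY w
  countY (y ∷ w) = suc (countY w)

  weight : (ℕ → ℕ → ℕ) → Word → ℕ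
  weight t w = t (countX w) (countY w)

  children : Word → List Word
  children w = map (replaceAt w) (allFin (length w))

  children-∷ : ∀ a w → children (a ∷ w) ≡ (image a ++ w) ∷ map (a ∷_) (children w)
  children-∷ a w = cong ((image a ++ w) ∷_) (begin
    map (replaceAt (a ∷ w)) (tabulate Fin.suc)  ≡⟨ map-tabulate Fin.suc (replaceAt (a ∷ w)) ⟩
    tabulate (λ i → a ∷ replaceAt w i)          ≡⟨ map-tabulate (replaceAt w) (a ∷_) ⟨
    map (a ∷_) (tabulate (replaceAt w))         ≡⟨ cong (map (a ∷_)) (map-tabulate id (replaceAt w)) ⟨
    map (a ∷_) (children w)                     ∎)
    where open ≡-Reasoning

  -- Final words of all n-step histories starting from w, one entry per history.
  descendants : Word → ℕ → List Word
  descendants w zero    = [ w ]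
  descendants w (suc n) = concatMap (λ v → descendants v n) (children w)

  descendants-suc : ∀ w n → descendants w (suc n) ≡ concatMap children (descendants w n)
  descendants-suc w zero    = trans (concatMap-pure (children w)) (sym (++-identityʳ (children w)))
  descendants-suc w (suc n) = trans (concatMap-cong (λ v → descendants-suc v n) (children w))
                                    (MonadProperties.associative (children w) (λ v → descendants v n) children)

  map-proj₂-histories : ∀ n → map proj₂ (histories n) ≡ descendants [ x ] n
  map-proj₂-histories zero    = refl
  map-proj₂-histories (suc n) = begin
    map proj₂ (histories (suc n))                 ≡⟨ map-concatMap proj₂ _ (histories n) ⟩
    concatMap (λ h → map proj₂ (map _ (allFin (length (proj₂ h))))) (histories n)
                                                  ≡⟨ concatMap-cong (λ h → map-∘ (allFin (length (proj₂ h)))) (histories n) ⟨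
    concatMap (children ∘ proj₂) (histories n)    ≡⟨ concatMap-map children proj₂ (histories n) ⟨
    concatMap children (map proj₂ (histories n))  ≡⟨ cong (concatMap children) (map-proj₂-histories n) ⟩
    concatMap children (descendants [ x ] n)      ≡⟨ descendants-suc [ x ] n ⟨
    descendants [ x ] (suc n)                     ∎
    where open ≡-Reasoning

  -- n-step histories of the urn with i balls x and j balls y, each weighted by t of its final
  -- composition.  The truncated i ∸ 1 and j ∸ 1 only occur multiplied by 0.
  urnCount : (ℕ → ℕ → ℕ) → ℕ → ℕ → ℕ → ℕ
  urnCount t zero    i j = t i j
  urnCount t (suc n) i j = i * urnCount t n (i ∸ 1) (2 + j) + j * urnCount t n (2 + i) (j ∸ 1)

  *-suc-pred : ∀ k (g : ℕ → ℕ) → k * g (suc (k ∸ 1)) ≡ k * g k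
  *-suc-pred zero    g = refl
  *-suc-pred (suc k) g = refl

  sum-map-concatMap : {A B : Set} (h : B → ℕ) (g : A → List B) (as : List A) →
    sum (map h (concatMap g as)) ≡ sum (map (sum ∘ map h ∘ g) as)
  sum-map-concatMap h g []       = refl
  sum-map-concatMap h g (a ∷ as) = begin
    sum (map h (g a ++ concatMap g as))               ≡⟨ cong sum (map-++ h (g a) (concatMap g as)) ⟩
    sum (map h (g a) ++ map h (concatMap g as))       ≡⟨ sum-++ (map h (g a)) _ ⟩
    sum (map h (g a)) + sum (map h (concatMap g as))  ≡⟨ cong (sum (map h (g a)) +_) (sum-map-concatMap h g as) ⟩
    sum (map h (g a)) + sum (map (sum ∘ map h ∘ g) as) ∎
    where open ≡-Reasoning

  sum-children : ∀ f w → sum (map (weight f) (children w))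
    ≡ countX w * f (countX w ∸ 1) (2 + countY w) + countY w * f (2 + countX w) (countY w ∸ 1)
  sum-children f [] = refl
  sum-children f (x ∷ w) = begin
    sum (map (weight f) (children (x ∷ w)))                   ≡⟨ cong (sum ∘ map (weight f)) (children-∷ x w) ⟩
    f i (2 + j) + sum (map (weight f) (map (x ∷_) (children w)))
                                                              ≡⟨ cong (λ s → f i (2 + j) + sum s) (map-∘ (children w)) ⟨
    f i (2 + j) + sum (map (weight (f ∘ suc)) (children w))   ≡⟨ cong (f i (2 + j) +_) (sum-children (f ∘ suc) w) ⟩
    f i (2 + j) + (i * f (suc (i ∸ 1)) (2 + j) + j * f (3 + i) (j ∸ 1))
                                                              ≡⟨ cong (λ s → f i (2 + j) + (s + j * f (3 + i) (j ∸ 1)))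
                                                                      (*-suc-pred i (λ k → f k (2 + j))) ⟩
    f i (2 + j) + (i * f i (2 + j) + j * f (3 + i) (j ∸ 1))   ≡⟨ +-assoc (f i (2 + j)) _ _ ⟨
    suc i * f i (2 + j) + j * f (3 + i) (j ∸ 1)               ∎
    where
    open ≡-Reasoning
    i j : ℕ
    i = countX w
    j = countY w
  sum-children f (y ∷ w) = begin
    sum (map (weight f) (children (y ∷ w)))                   ≡⟨ cong (sum ∘ map (weight f)) (children-∷ y w) ⟩
    f (2 + i) j + sum (map (weight f) (map (y ∷_) (children w)))
                                                              ≡⟨ cong (λ s → f (2 + i) j + sum s) (map-∘ (children w)) ⟨
    f (2 + i) j + sum (map (weight (λ a b → f a (suc b))) (children w))
                                                              ≡⟨ cong (f (2 + i) j +_) (sum-children (λ a b → f a (suc b)) w) ⟩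
    f (2 + i) j + (i * f (i ∸ 1) (3 + j) + j * f (2 + i) (suc (j ∸ 1)))
                                                              ≡⟨ cong (λ s → f (2 + i) j + (i * f (i ∸ 1) (3 + j) + s))
                                                                      (*-suc-pred j (f (2 + i))) ⟩
    f (2 + i) j + (i * f (i ∸ 1) (3 + j) + j * f (2 + i) j)   ≡⟨ x∙yz≈y∙xz (f (2 + i) j) (i * f (i ∸ 1) (3 + j)) (j * f (2 + i) j) ⟩
    i * f (i ∸ 1) (3 + j) + suc j * f (2 + i) j               ∎
    where
    open ≡-Reasoning
    i j : ℕ
    i = countX w
    j = countY w

  sum-descendants : ∀ t n w → sum (map (weight t) (descendants w n)) ≡ urnCount t n (countX w) (countY w)
  sum-descendants t zero    w = +-identityʳ (weight t w)
  sum-descendants t (suc n) w = begin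
    sum (map (weight t) (concatMap (λ v → descendants v n) (children w)))  ≡⟨ sum-map-concatMap (weight t) _ (children w) ⟩
    sum (map (λ v → sum (map (weight t) (descendants v n))) (children w)) ≡⟨ cong sum (map-cong (sum-descendants t n) (children w)) ⟩
    sum (map (weight (urnCount t n)) (children w))                        ≡⟨ sum-children (urnCount t n) w ⟩
    urnCount t (suc n) (countX w) (countY w)                              ∎
    where open ≡-Reasoning

  length-filter≡sum : {A : Set} {P : A → Set} (P? : ∀ a → Dec (P a)) (as : List A) →
    length (filter P? as) ≡ sum (map (λ a → if does (P? a) then 1 else 0) as)
  length-filter≡sum P? []       = refl
  length-filter≡sum P? (a ∷ as) with does (P? a)
  ... | true  = cong suc (length-filter≡sum P? as)
  ... | false = length-filter≡sum P? as

  hasX : ℕ → ℕ → ℕ → ℕ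
  hasX k i _ = if does (i ≟ k) then 1 else 0

  noY : ℕ → ℕ → ℕ
  noY _ j = if does (j ≟ 0) then 1 else 0

  H≡urnCount : ∀ n k → H n k ≡ urnCount (hasX k) n 1 0
  H≡urnCount n k = begin
    H n k                                                ≡⟨ length-filter≡sum _ (histories n) ⟩
    sum (map (weight (hasX k) ∘ proj₂) (histories n))     ≡⟨ cong sum (map-∘ (histories n)) ⟩
    sum (map (weight (hasX k)) (map proj₂ (histories n))) ≡⟨ cong (sum ∘ map (weight (hasX k))) (map-proj₂-histories n) ⟩
    sum (map (weight (hasX k)) (descendants [ x ] n))     ≡⟨ sum-descendants (hasX k) n [ x ] ⟩
    urnCount (hasX k) n 1 0                              ∎
    where open ≡-Reasoning

  -- Every step adds one ball, so only the weights on the line i + j = s are ever used.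
  urnCount-local : ∀ {t t′} s → (∀ i j → i + j ≡ s → t i j ≡ t′ i j) →
    ∀ n i j → i + j + n ≡ s → urnCount t n i j ≡ urnCount t′ n i j
  urnCount-local s t≡t′ zero    i j eq = t≡t′ i j (trans (sym (+-identityʳ (i + j))) eq)
  urnCount-local {t} {t′} s t≡t′ (suc n) i j eq = cong₂ _+_ (drawX i eq) (drawY j eq)
    where
    drawX : ∀ i → i + j + suc n ≡ s → i * urnCount t n (i ∸ 1) (2 + j) ≡ i * urnCount t′ n (i ∸ 1) (2 + j)
    drawX zero    _  = refl
    drawX (suc i) eq = cong (suc i *_) (urnCount-local s t≡t′ n i (2 + j) (trans (balls i j n) eq))
      where balls : ∀ i j n → i + (2 + j) + n ≡ suc i + j + suc n
            balls = solve-∀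
    drawY : ∀ j → i + j + suc n ≡ s → j * urnCount t n (2 + i) (j ∸ 1) ≡ j * urnCount t′ n (2 + i) (j ∸ 1)
    drawY zero    _  = refl
    drawY (suc j) eq = cong (suc j *_) (urnCount-local s t≡t′ n (2 + i) j (trans (balls i j n) eq))
      where balls : ∀ i j n → 2 + i + j + n ≡ i + suc j + suc n
            balls = solve-∀

  H-top≡urnCount : ∀ n → H n (suc n) ≡ urnCount noY n 1 0
  H-top≡urnCount n = trans (H≡urnCount n (suc n)) (urnCount-local (suc n) all-x⇔no-y n 1 0 refl)
    where
    all-x⇔no-y : ∀ i j → i + j ≡ suc n → hasX (suc n) i j ≡ noY i j
    all-x⇔no-y i zero    eq = cong (λ d → if does d then 1 else 0) (≡-≟-identity _≟_ {i} {suc n} (trans (sym (+-identityʳ i)) eq))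
    all-x⇔no-y i (suc j) eq = cong (λ d → if does d then 1 else 0) (≢-≟-identity _≟_ {i} {suc n} (λ { refl → m+1+n≢m (suc n) eq }))

open Urn using (urnCount; hasX; noY; H≡urnCount; H-top≡urnCount)

open import Data.Nat.Properties using (_!≢0)
import Data.Nat.Properties as ℕₚ
open import Data.Integer as ℤ using (ℤ; +_)
import Data.Integer.Properties as ℤₚ
open import Data.Rational as ℚ using (ℚ; 0ℚ; 1ℚ; -_; _*_; _+_; _/_; 1/_; NonZero; toℚᵘ)
open import Data.Rational.Properties
  using ( toℚᵘ-injective; toℚᵘ-fromℚᵘ; toℚᵘ-homo-+; toℚᵘ-homo-*; normalize-pos; pos⇒nonZero; *-inverseˡ
        ; +-comm; +-assoc; +-identityˡ; +-identityʳ; +-inverseʳ; *-comm; *-assoc; *-identityˡ; *-identityʳ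
        ; *-zeroˡ; *-zeroʳ; *-distribˡ-+; *-distribʳ-+; neg-distribˡ-*; neg-distribʳ-*; neg-distrib-+)
open import Data.Rational.Unnormalised using (mkℚᵘ; *≡*) renaming (_≃_ to _≃ᵘ_)
import Data.Rational.Unnormalised.Properties as ℚᵘₚ
open import Data.Rational.Solver using (module +-*-Solver)
open import Relation.Binary.Bundles using (Setoid)
import Relation.Binary.Reasoning.Setoid as SetoidReasoning
open import Relation.Nullary using (yes; no)
open import Data.Empty using (⊥-elim)
open import Level using (0ℓ)
open import Algebra.Bundles using (CommutativeSemiring)
open import Algebra.Structures.Biased {A = PS} _≐_ using (isCommutativeSemiringˡ)
import Algebra.Solver.Ring.NaturalCoefficients.Default as NaturalCoefficientsSolver

toℚᵘ-/ : ∀ (i : ℤ) d .{{_ : ℕ.NonZero d}} → toℚᵘ (i / d) ≃ᵘ mkℚᵘ i (ℕ.pred d)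
toℚᵘ-/ i (suc d) = toℚᵘ-fromℚᵘ (mkℚᵘ i d)

/-+-/ : ∀ (a b : ℤ) d e .{{_ : ℕ.NonZero d}} .{{_ : ℕ.NonZero e}} →
        a / d + b / e ≡ _/_ (a ℤ.* + e ℤ.+ b ℤ.* + d) (d ℕ.* e) {{ℕₚ.m*n≢0 d e}}
/-+-/ a b (suc d) (suc e) = toℚᵘ-injective (ℚᵘₚ.≃-trans (toℚᵘ-homo-+ (a / suc d) (b / suc e))
  (ℚᵘₚ.≃-trans (ℚᵘₚ.+-cong (toℚᵘ-/ a (suc d)) (toℚᵘ-/ b (suc e))) (ℚᵘₚ.≃-sym (toℚᵘ-/ _ (suc d ℕ.* suc e)))))

/-*-/ : ∀ (a b : ℤ) d e .{{_ : ℕ.NonZero d}} .{{_ : ℕ.NonZero e}} →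
        (a / d) * (b / e) ≡ _/_ (a ℤ.* b) (d ℕ.* e) {{ℕₚ.m*n≢0 d e}}
/-*-/ a b (suc d) (suc e) = toℚᵘ-injective (ℚᵘₚ.≃-trans (toℚᵘ-homo-* (a / suc d) (b / suc e))
  (ℚᵘₚ.≃-trans (ℚᵘₚ.*-cong (toℚᵘ-/ a (suc d)) (toℚᵘ-/ b (suc e))) (ℚᵘₚ.≃-sym (toℚᵘ-/ _ (suc d ℕ.* suc e)))))

/-cross : ∀ (a b : ℤ) d e .{{_ : ℕ.NonZero d}} .{{_ : ℕ.NonZero e}} → a ℤ.* + e ≡ b ℤ.* + d → a / d ≡ b / e
/-cross a b (suc d) (suc e) eq =
  toℚᵘ-injective (ℚᵘₚ.≃-trans (toℚᵘ-/ a (suc d)) (ℚᵘₚ.≃-trans (*≡* eq) (ℚᵘₚ.≃-sym (toℚᵘ-/ b (suc e)))))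

-- deriv f n and reflect f n are definitionally ι (suc n) * f (suc n) and σ n * f n.
ι : ℕ → ℚ
ι n = + n / 1

+/-distrib-+ : ∀ a b m .{{_ : ℕ.NonZero m}} → + (a ℕ.+ b) / m ≡ + a / m + + b / m
+/-distrib-+ a b m = sym (trans (/-+-/ (+ a) (+ b) m m)
  (/-cross (+ a ℤ.* + m ℤ.+ + b ℤ.* + m) (+ (a ℕ.+ b)) (m ℕ.* m) m {{ℕₚ.m*n≢0 m m}}
    (trans (ℤ-identity (+ a) (+ b) (+ m)) (sym (cong₂ ℤ._*_ (ℤₚ.pos-+ a b) (ℤₚ.pos-* m m))))))
  where ℤ-identity : ∀ a b m → (a ℤ.* m ℤ.+ b ℤ.* m) ℤ.* m ≡ (a ℤ.+ b) ℤ.* (m ℤ.* m)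
        ℤ-identity = solve-∀ where open import Data.Integer.Tactic.RingSolver using (solve-∀)

+/-*ˡ : ∀ i a m .{{_ : ℕ.NonZero m}} → + (i ℕ.* a) / m ≡ ι i * (+ a / m)
+/-*ˡ i a m = sym (trans (/-*-/ (+ i) (+ a) 1 m)
  (/-cross (+ i ℤ.* + a) (+ (i ℕ.* a)) (1 ℕ.* m) m {{ℕₚ.m*n≢0 1 m}}
    (sym (cong₂ ℤ._*_ (ℤₚ.pos-* i a) (cong +_ (ℕₚ.*-identityˡ m))))))

ι-+ : ∀ m n → ι (m ℕ.+ n) ≡ ι m + ι n
ι-+ m n = +/-distrib-+ m n 1

ι-cancel-/ : ∀ n a m .{{_ : ℕ.NonZero m}} → ι (suc n) * _/_ (+ a) (suc n ℕ.* m) {{ℕₚ.m*n≢0 (suc n) m}} ≡ + a / m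
ι-cancel-/ n a m = trans (sym (+/-*ˡ (suc n) a (suc n ℕ.* m) {{ℕₚ.m*n≢0 (suc n) m}}))
  (/-cross (+ (suc n ℕ.* a)) (+ a) (suc n ℕ.* m) m {{ℕₚ.m*n≢0 (suc n) m}}
    (trans (sym (ℤₚ.pos-* (suc n ℕ.* a) m)) (trans (cong +_ (ℕ-identity (suc n) a m)) (ℤₚ.pos-* a (suc n ℕ.* m)))))
  where ℕ-identity : ∀ n a m → n ℕ.* a ℕ.* m ≡ a ℕ.* (n ℕ.* m)
        ℕ-identity = solve-∀ where open import Data.Nat.Tactic.RingSolver using (solve-∀)

ι-cancel : ∀ n {p q} → ι (suc n) * p ≡ ι (suc n) * q → p ≡ q
ι-cancel n {p} {q} eq = trans (sym (unscale p)) (trans (cong (r *_) eq) (unscale q))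
  where
  instance ι≢0 : NonZero (ι (suc n))
  ι≢0 = pos⇒nonZero (ι (suc n)) {{normalize-pos (suc n) 1}}
  r : ℚ
  r = 1/ ι (suc n)
  unscale : ∀ p → r * (ι (suc n) * p) ≡ p
  unscale p = trans (sym (*-assoc r (ι (suc n)) p)) (trans (cong (_* p) (*-inverseˡ (ι (suc n)))) (*-identityˡ p))

σ : ℕ → ℚ
σ n = (ℤ.- + 1) ℤ.^ n / 1

σ-+ : ∀ a b → σ (a ℕ.+ b) ≡ σ a * σ b
σ-+ a b = trans (cong (_/ 1) (ℤₚ.^-distribˡ-+-* (ℤ.- + 1) a b)) (sym (/-*-/ ((ℤ.- + 1) ℤ.^ a) ((ℤ.- + 1) ℤ.^ b) 1 1))

σ-suc : ∀ n → σ (suc n) ≡ - σ n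
σ-suc n = trans (σ-+ 1 n) (trans (sym (neg-distribˡ-* 1ℚ (σ n))) (cong -_ (*-identityˡ (σ n))))

-- Formal power series

open +-*-Solver using (solve; _:=_; _:+_; _:*_; :-_; con)

sumTo-cong : ∀ n {f g : ℕ → ℚ} → (∀ i → i ℕ.≤ n → f i ≡ g i) → sumTo n f ≡ sumTo n g
sumTo-cong zero    f≡g = f≡g 0 ℕ.z≤n
sumTo-cong (suc n) f≡g = cong₂ _+_ (sumTo-cong n (λ i i≤n → f≡g i (ℕₚ.m≤n⇒m≤1+n i≤n))) (f≡g (suc n) ℕₚ.≤-refl)

sumTo-cong′ : ∀ n {f g : ℕ → ℚ} → (∀ i → f i ≡ g i) → sumTo n f ≡ sumTo n g
sumTo-cong′ n f≡g = sumTo-cong n (λ i _ → f≡g i)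

sumTo-+ : ∀ n (f g : ℕ → ℚ) → sumTo n (λ i → f i + g i) ≡ sumTo n f + sumTo n g
sumTo-+ zero    f g = refl
sumTo-+ (suc n) f g = trans (cong (_+ (f (suc n) + g (suc n))) (sumTo-+ n f g))
  (solve 4 (λ a b c d → (a :+ b) :+ (c :+ d) := (a :+ c) :+ (b :+ d)) refl (sumTo n f) (sumTo n g) (f (suc n)) (g (suc n)))

*-sumTo : ∀ n c (f : ℕ → ℚ) → c * sumTo n f ≡ sumTo n (λ i → c * f i)
*-sumTo zero    c f = refl
*-sumTo (suc n) c f = trans (*-distribˡ-+ c (sumTo n f) (f (suc n))) (cong (_+ c * f (suc n)) (*-sumTo n c f))

sumTo-neg : ∀ n (f : ℕ → ℚ) → sumTo n (λ i → - f i) ≡ - sumTo n f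
sumTo-neg zero    f = refl
sumTo-neg (suc n) f = trans (cong (_+ - f (suc n)) (sumTo-neg n f)) (sym (neg-distrib-+ (sumTo n f) (f (suc n))))

sumTo-zero : ∀ n (f : ℕ → ℚ) → (∀ i → f i ≡ 0ℚ) → sumTo n f ≡ 0ℚ
sumTo-zero zero    f f≡0 = f≡0 0
sumTo-zero (suc n) f f≡0 = cong₂ _+_ (sumTo-zero n f f≡0) (f≡0 (suc n))

sumTo-suc : ∀ n (f : ℕ → ℚ) → sumTo (suc n) f ≡ f 0 + sumTo n (λ i → f (suc i))
sumTo-suc zero    f = refl
sumTo-suc (suc n) f = trans (cong (_+ f (suc (suc n))) (sumTo-suc n f)) (+-assoc (f 0) _ _)

infixl 6 _⊕_
_⊕_ : PS → PS → PS
(f ⊕ g) n = f n + g n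

zeroPS : PS
zeroPS _ = 0ℚ

scal : ℚ → PS → PS
scal c f n = c * f n

shift : PS → PS
shift f n = f (suc n)

≐-refl : ∀ {f} → f ≐ f
≐-refl n = refl

≐-sym : ∀ {f g} → f ≐ g → g ≐ f
≐-sym p n = sym (p n)

≐-trans : ∀ {f g h} → f ≐ g → g ≐ h → f ≐ h
≐-trans p q n = trans (p n) (q n)

≐-setoid : Setoid 0ℓ 0ℓ
≐-setoid = record
  { Carrier = PS ; _≈_ = _≐_
  ; isEquivalence = record { refl = λ {f} → ≐-refl {f} ; sym = λ {f} {g} → ≐-sym {f} {g} ; trans = λ {f} {g} {h} → ≐-trans {f} {g} {h} } }

module ≐-Reasoning = SetoidReasoning ≐-setoid

⊕-cong : ∀ {f f′ g g′} → f ≐ f′ → g ≐ g′ → (f ⊕ g) ≐ (f′ ⊕ g′)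
⊕-cong p q n = cong₂ _+_ (p n) (q n)

⊛-cong : ∀ {f f′ g g′} → f ≐ f′ → g ≐ g′ → (f ⊛ g) ≐ (f′ ⊛ g′)
⊛-cong p q n = sumTo-cong′ n (λ i → cong₂ _*_ (p i) (q (n ∸ i)))

⊛-congˡ : ∀ {f f′} g → f ≐ f′ → (f ⊛ g) ≐ (f′ ⊛ g)
⊛-congˡ {f} {f′} g p = ⊛-cong {f} {f′} {g} {g} p ≐-refl

⊛-congʳ : ∀ f {g g′} → g ≐ g′ → (f ⊛ g) ≐ (f ⊛ g′)
⊛-congʳ f {g} {g′} p = ⊛-cong {f} {f} {g} {g′} ≐-refl p

⊛-suc : ∀ f g n → (f ⊛ g) (suc n) ≡ f 0 * g (suc n) + (shift f ⊛ g) n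
⊛-suc f g n = sumTo-suc n (λ i → f i * g (suc n ∸ i))

⊛-sucʳ : ∀ f g n → (f ⊛ g) (suc n) ≡ (f ⊛ shift g) n + f (suc n) * g 0
⊛-sucʳ f g n = cong₂ _+_
  (sumTo-cong n (λ i i≤n → cong (λ k → f i * g k) (ℕₚ.+-∸-assoc 1 i≤n)))
  (cong (λ k → f (suc n) * g k) (ℕₚ.n∸n≡0 n))

⊛-distribʳ : ∀ f g h → ((f ⊕ g) ⊛ h) ≐ ((f ⊛ h) ⊕ (g ⊛ h))
⊛-distribʳ f g h n = trans (sumTo-cong′ n (λ i → *-distribʳ-+ (h (n ∸ i)) (f i) (g i))) (sumTo-+ n _ _)

⊛-zeroˡ : ∀ g → (zeroPS ⊛ g) ≐ zeroPS
⊛-zeroˡ g n = sumTo-zero n _ (λ i → *-zeroˡ (g (n ∸ i)))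

scal-⊛ : ∀ c f g → (scal c f ⊛ g) ≐ scal c (f ⊛ g)
scal-⊛ c f g n = trans (sumTo-cong′ n (λ i → *-assoc c (f i) (g (n ∸ i)))) (sym (*-sumTo n c _))

⊛-negʳ : ∀ f g → (f ⊛ negPS g) ≐ negPS (f ⊛ g)
⊛-negʳ f g n = trans (sumTo-cong′ n (λ i → sym (neg-distribʳ-* (f i) (g (n ∸ i))))) (sumTo-neg n _)

⊛-comm : ∀ f g → (f ⊛ g) ≐ (g ⊛ f)
⊛-comm f g zero    = *-comm (f 0) (g 0)
⊛-comm f g (suc n) = begin
  (f ⊛ g) (suc n)                      ≡⟨ ⊛-suc f g n ⟩
  f 0 * g (suc n) + (shift f ⊛ g) n    ≡⟨ cong₂ _+_ (*-comm (f 0) (g (suc n))) (⊛-comm (shift f) g n) ⟩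
  g (suc n) * f 0 + (g ⊛ shift f) n    ≡⟨ +-comm (g (suc n) * f 0) ((g ⊛ shift f) n) ⟩
  (g ⊛ shift f) n + g (suc n) * f 0    ≡⟨ ⊛-sucʳ g f n ⟨
  (g ⊛ f) (suc n)                      ∎
  where open ≡-Reasoning

⊛-assoc : ∀ f g h → ((f ⊛ g) ⊛ h) ≐ (f ⊛ (g ⊛ h))
⊛-assoc f g h zero    = *-assoc (f 0) (g 0) (h 0)
⊛-assoc f g h (suc n) = begin
  ((f ⊛ g) ⊛ h) (suc n)                                             ≡⟨ ⊛-suc (f ⊛ g) h n ⟩
  f 0 * g 0 * h (suc n) + (shift (f ⊛ g) ⊛ h) n
      ≡⟨ cong (_+_ (f 0 * g 0 * h (suc n))) (⊛-congˡ h (λ k → ⊛-suc f g k) n) ⟩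
  f 0 * g 0 * h (suc n) + ((scal (f 0) (shift g) ⊕ (shift f ⊛ g)) ⊛ h) n
      ≡⟨ cong (_+_ (f 0 * g 0 * h (suc n))) (⊛-distribʳ (scal (f 0) (shift g)) (shift f ⊛ g) h n) ⟩
  f 0 * g 0 * h (suc n) + ((scal (f 0) (shift g) ⊛ h) n + ((shift f ⊛ g) ⊛ h) n)
      ≡⟨ cong₂ (λ a b → f 0 * g 0 * h (suc n) + (a + b)) (scal-⊛ (f 0) (shift g) h n) (⊛-assoc (shift f) g h n) ⟩
  f 0 * g 0 * h (suc n) + (f 0 * (shift g ⊛ h) n + (shift f ⊛ (g ⊛ h)) n)
      ≡⟨ solve 5 (λ a b c d e → (a :* b) :* c :+ (a :* d :+ e) := a :* (b :* c :+ d) :+ e) refl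
           (f 0) (g 0) (h (suc n)) ((shift g ⊛ h) n) ((shift f ⊛ (g ⊛ h)) n) ⟩
  f 0 * (g 0 * h (suc n) + (shift g ⊛ h) n) + (shift f ⊛ (g ⊛ h)) n
      ≡⟨ cong (λ a → f 0 * a + (shift f ⊛ (g ⊛ h)) n) (⊛-suc g h n) ⟨
  f 0 * (g ⊛ h) (suc n) + (shift f ⊛ (g ⊛ h)) n                     ≡⟨ ⊛-suc f (g ⊛ h) n ⟨
  (f ⊛ (g ⊛ h)) (suc n)                                             ∎
  where open ≡-Reasoning

⊛-identityˡ : ∀ f → (onePS ⊛ f) ≐ f
⊛-identityˡ f zero    = *-identityˡ (f 0)
⊛-identityˡ f (suc n) = trans (⊛-suc onePS f n)
  (trans (cong₂ _+_ (*-identityˡ (f (suc n))) (⊛-zeroˡ f n)) (+-identityʳ (f (suc n))))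

⊛-identityʳ : ∀ f → (f ⊛ onePS) ≐ f
⊛-identityʳ f = ≐-trans {f ⊛ onePS} {onePS ⊛ f} (⊛-comm f onePS) (⊛-identityˡ f)

PS-commutativeSemiring : CommutativeSemiring 0ℓ 0ℓ
PS-commutativeSemiring = record
  { Carrier = PS ; _≈_ = _≐_ ; _+_ = _⊕_ ; _*_ = _⊛_ ; 0# = zeroPS ; 1# = onePS
  ; isCommutativeSemiring = isCommutativeSemiringˡ (record
      { +-isCommutativeMonoid = record
          { isMonoid = record
            { isSemigroup = record
              { isMagma = record { isEquivalence = Setoid.isEquivalence ≐-setoid ; ∙-cong = ⊕-cong }
              ; assoc = λ f g h n → +-assoc (f n) (g n) (h n) }
            ; identity = (λ f n → +-identityˡ (f n)) , (λ f n → +-identityʳ (f n)) }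
          ; comm = λ f g n → +-comm (f n) (g n) }
      ; *-isCommutativeMonoid = record
          { isMonoid = record
            { isSemigroup = record
              { isMagma = record { isEquivalence = Setoid.isEquivalence ≐-setoid ; ∙-cong = ⊛-cong }
              ; assoc = ⊛-assoc }
            ; identity = ⊛-identityˡ , ⊛-identityʳ }
          ; comm = ⊛-comm }
      ; distribʳ = λ h f g → ⊛-distribʳ f g h
      ; zeroˡ = ⊛-zeroˡ }) }

open NaturalCoefficientsSolver PS-commutativeSemiring using ()
  renaming (solve to PS-solve; _:=_ to _:=ₚ_; _:+_ to _:+ₚ_; _:*_ to _:*ₚ_; con to conₚ)

pow : PS → ℕ → PS
pow f zero    = onePS
pow f (suc m) = f ⊛ pow f m

natPS : ℕ → PS
natPS n zero    = ι n
natPS n (suc k) = 0ℚ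

natPS-⊛ : ∀ n f → (natPS n ⊛ f) ≐ scal (ι n) f
natPS-⊛ n f zero    = refl
natPS-⊛ n f (suc k) = trans (⊛-suc (natPS n) f k) (trans (cong (_+_ (ι n * f (suc k))) (⊛-zeroˡ f k)) (+-identityʳ _))

natPS-suc : ∀ n → natPS (suc n) ≐ (onePS ⊕ natPS n)
natPS-suc n zero    = ι-+ 1 n
natPS-suc n (suc k) = sym (+-identityˡ 0ℚ)

natPS-zero : natPS 0 ≐ zeroPS
natPS-zero zero    = refl
natPS-zero (suc k) = refl

negPS-cong : ∀ {f g} → f ≐ g → negPS f ≐ negPS g
negPS-cong p n = cong -_ (p n)

negPS-involutive : ∀ f → negPS (negPS f) ≐ f
negPS-involutive f n = solve 1 (λ a → :- (:- a) := a) refl (f n)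

neg-⊛-neg : ∀ f g → (negPS f ⊛ negPS g) ≐ (f ⊛ g)
neg-⊛-neg f g = begin
  negPS f ⊛ negPS g        ≈⟨ ⊛-negʳ (negPS f) g ⟩
  negPS (negPS f ⊛ g)      ≈⟨ negPS-cong (⊛-comm (negPS f) g) ⟩
  negPS (g ⊛ negPS f)      ≈⟨ negPS-cong (⊛-negʳ g f) ⟩
  negPS (negPS (g ⊛ f))    ≈⟨ negPS-involutive (g ⊛ f) ⟩
  g ⊛ f                    ≈⟨ ⊛-comm g f ⟩
  f ⊛ g                    ∎
  where open ≐-Reasoning

neg-⊕≐zero⇒≐ : ∀ {f g} → (negPS f ⊕ g) ≐ zeroPS → g ≐ f
neg-⊕≐zero⇒≐ {f} {g} p n = trans (solve 2 (λ a b → b := a :+ (:- a :+ b)) refl (f n) (g n))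
  (trans (cong (_+_ (f n)) (p n)) (+-identityʳ (f n)))

pow-constant-one : ∀ f m → f 0 ≡ 1ℚ → pow f m 0 ≡ 1ℚ
pow-constant-one f zero    _  = refl
pow-constant-one f (suc m) f0 = trans (cong₂ _*_ f0 (pow-constant-one f m f0)) (*-identityˡ 1ℚ)

pow-constant-zero : ∀ f m → f 0 ≡ 0ℚ → pow f (suc m) 0 ≡ 0ℚ
pow-constant-zero f m f0 = trans (cong (_* pow f m 0) f0) (*-zeroˡ (pow f m 0))

pow-constant-cong : ∀ f g m → f 0 ≡ g 0 → pow f m 0 ≡ pow g m 0
pow-constant-cong f g zero    _  = refl
pow-constant-cong f g (suc m) fg = cong₂ _*_ fg (pow-constant-cong f g m fg)

deriv-cong : ∀ {f g} → f ≐ g → deriv f ≐ deriv g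
deriv-cong p n = cong (ι (suc n) *_) (p (suc n))

deriv-⊕ : ∀ f g → deriv (f ⊕ g) ≐ (deriv f ⊕ deriv g)
deriv-⊕ f g n = *-distribˡ-+ (ι (suc n)) (f (suc n)) (g (suc n))

deriv-onePS : deriv onePS ≐ zeroPS
deriv-onePS n = *-zeroʳ (ι (suc n))

deriv-neg : ∀ f → deriv (negPS f) ≐ negPS (deriv f)
deriv-neg f n = sym (neg-distribʳ-* (ι (suc n)) (f (suc n)))

-- The Euler operator z d/dz; it is a derivation because i + (n ∸ i) = n.
euler : PS → PS
euler f n = ι n * f n

euler-⊛ : ∀ f g → euler (f ⊛ g) ≐ ((euler f ⊛ g) ⊕ (f ⊛ euler g))
euler-⊛ f g n = sym (begin
  (euler f ⊛ g) n + (f ⊛ euler g) n                                     ≡⟨ sumTo-+ n _ _ ⟨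
  sumTo n (λ i → ι i * f i * g (n ∸ i) + f i * (ι (n ∸ i) * g (n ∸ i)))  ≡⟨ sumTo-cong n split ⟩
  sumTo n (λ i → ι n * (f i * g (n ∸ i)))                               ≡⟨ *-sumTo n (ι n) _ ⟨
  ι n * (f ⊛ g) n                                                       ∎)
  where
  open ≡-Reasoning
  split : ∀ i → i ℕ.≤ n → ι i * f i * g (n ∸ i) + f i * (ι (n ∸ i) * g (n ∸ i)) ≡ ι n * (f i * g (n ∸ i))
  split i i≤n = trans (solve 4 (λ a b c d → (a :* c) :* d :+ c :* (b :* d) := (a :+ b) :* (c :* d)) refl
                         (ι i) (ι (n ∸ i)) (f i) (g (n ∸ i)))
                      (cong (_* (f i * g (n ∸ i))) (trans (sym (ι-+ i (n ∸ i))) (cong ι (ℕₚ.m+[n∸m]≡n i≤n))))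

deriv-⊛ : ∀ f g → deriv (f ⊛ g) ≐ ((deriv f ⊛ g) ⊕ (f ⊛ deriv g))
deriv-⊛ f g n = begin
  deriv (f ⊛ g) n                                 ≡⟨ euler-⊛ f g (suc n) ⟩
  (euler f ⊛ g) (suc n) + (f ⊛ euler g) (suc n)   ≡⟨ cong (_+_ ((euler f ⊛ g) (suc n))) (⊛-comm f (euler g) (suc n)) ⟩
  (euler f ⊛ g) (suc n) + (euler g ⊛ f) (suc n)   ≡⟨ cong₂ _+_ (euler-shift f g) (euler-shift g f) ⟩
  (deriv f ⊛ g) n + (deriv g ⊛ f) n               ≡⟨ cong (_+_ ((deriv f ⊛ g) n)) (⊛-comm (deriv g) f n) ⟩
  (deriv f ⊛ g) n + (f ⊛ deriv g) n               ∎
  where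
  open ≡-Reasoning
  euler-shift : ∀ f g → (euler f ⊛ g) (suc n) ≡ (deriv f ⊛ g) n
  euler-shift f g = trans (⊛-suc (euler f) g n)
    (trans (cong (λ a → a * g (suc n) + (deriv f ⊛ g) n) (*-zeroˡ (f 0)))
      (trans (cong (_+ (deriv f ⊛ g) n) (*-zeroˡ (g (suc n)))) (+-identityˡ _)))

deriv-pow : ∀ f m → deriv (pow f m) ≐ (natPS m ⊛ (pow f (m ∸ 1) ⊛ deriv f))
deriv-pow f zero = begin
  deriv onePS                  ≈⟨ deriv-onePS ⟩
  zeroPS                       ≈⟨ ⊛-zeroˡ (onePS ⊛ deriv f) ⟨
  zeroPS ⊛ (onePS ⊛ deriv f)   ≈⟨ ⊛-congˡ (onePS ⊛ deriv f) natPS-zero ⟨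
  natPS 0 ⊛ (onePS ⊛ deriv f)  ∎
  where open ≐-Reasoning
deriv-pow f (suc zero) = begin
  deriv (f ⊛ onePS)                        ≈⟨ deriv-⊛ f onePS ⟩
  (deriv f ⊛ onePS) ⊕ (f ⊛ deriv onePS)    ≈⟨ ⊕-cong (≐-refl {deriv f ⊛ onePS}) (⊛-congʳ f deriv-onePS) ⟩
  (deriv f ⊛ onePS) ⊕ (f ⊛ zeroPS)
    ≈⟨ PS-solve 2 (λ d g → d :*ₚ conₚ 1 :+ₚ g :*ₚ conₚ 0 :=ₚ (conₚ 1 :+ₚ conₚ 0) :*ₚ (conₚ 1 :*ₚ d)) ≐-refl (deriv f) f ⟩
  (onePS ⊕ zeroPS) ⊛ (onePS ⊛ deriv f)     ≈⟨ ⊛-congˡ (onePS ⊛ deriv f) (≐-trans (natPS-suc 0) (⊕-cong (≐-refl {onePS}) natPS-zero)) ⟨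
  natPS 1 ⊛ (onePS ⊛ deriv f)              ∎
  where open ≐-Reasoning
deriv-pow f (suc (suc m)) = begin
  deriv (f ⊛ pow f (suc m))                                 ≈⟨ deriv-⊛ f (pow f (suc m)) ⟩
  (deriv f ⊛ pow f (suc m)) ⊕ (f ⊛ deriv (pow f (suc m)))   ≈⟨ ⊕-cong (≐-refl {deriv f ⊛ pow f (suc m)}) (⊛-congʳ f (deriv-pow f (suc m))) ⟩
  (deriv f ⊛ (f ⊛ pow f m)) ⊕ (f ⊛ (natPS (suc m) ⊛ (pow f m ⊛ deriv f)))
    ≈⟨ PS-solve 4 (λ d g P N → d :*ₚ (g :*ₚ P) :+ₚ g :*ₚ (N :*ₚ (P :*ₚ d)) :=ₚ (conₚ 1 :+ₚ N) :*ₚ ((g :*ₚ P) :*ₚ d))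
         ≐-refl (deriv f) f (pow f m) (natPS (suc m)) ⟩
  (onePS ⊕ natPS (suc m)) ⊛ (pow f (suc m) ⊛ deriv f)       ≈⟨ ⊛-congˡ (pow f (suc m) ⊛ deriv f) (natPS-suc (suc m)) ⟨
  natPS (suc (suc m)) ⊛ (pow f (suc m) ⊛ deriv f)           ∎
  where open ≐-Reasoning

deriv≐zero⇒≐onePS : ∀ f → deriv f ≐ zeroPS → f 0 ≡ 1ℚ → f ≐ onePS
deriv≐zero⇒≐onePS f f′≐0 f0 zero    = f0
deriv≐zero⇒≐onePS f f′≐0 f0 (suc n) = ι-cancel n (trans (f′≐0 n) (sym (*-zeroʳ (ι (suc n)))))

deriv-egf : ∀ a → deriv (egf a) ≐ egf (λ n → a (suc n))
deriv-egf a n = ι-cancel-/ n (a (suc n)) (n !) {{n !≢0}}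

egf-cong : ∀ {a b} → (∀ n → a n ≡ b n) → egf a ≐ egf b
egf-cong a≡b n = cong (λ h → egf (λ _ → h) n) (a≡b n)

egf-+ : ∀ a b → egf (λ n → a n ℕ.+ b n) ≐ (egf a ⊕ egf b)
egf-+ a b n = +/-distrib-+ (a n) (b n) (n !) {{n !≢0}}

egf-*ˡ : ∀ i a → egf (λ n → i ℕ.* a n) ≐ scal (ι i) (egf a)
egf-*ˡ i a n = +/-*ˡ i (a n) (n !) {{n !≢0}}

reflect-cong : ∀ {f g} → f ≐ g → reflect f ≐ reflect g
reflect-cong p n = cong (σ n *_) (p n)

reflect-neg : ∀ f → reflect (negPS f) ≐ negPS (reflect f)
reflect-neg f n = sym (neg-distribʳ-* (σ n) (f n))

reflect-⊛ : ∀ f g → reflect (f ⊛ g) ≐ (reflect f ⊛ reflect g)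
reflect-⊛ f g n = trans (*-sumTo n (σ n) _) (sumTo-cong n (λ i i≤n → begin
  σ n * (f i * g (n ∸ i))                  ≡⟨ cong (λ k → σ k * (f i * g (n ∸ i))) (ℕₚ.m+[n∸m]≡n i≤n) ⟨
  σ (i ℕ.+ (n ∸ i)) * (f i * g (n ∸ i))    ≡⟨ cong (_* (f i * g (n ∸ i))) (σ-+ i (n ∸ i)) ⟩
  σ i * σ (n ∸ i) * (f i * g (n ∸ i))      ≡⟨ solve 4 (λ a b c d → (a :* b) :* (c :* d) := (a :* c) :* (b :* d)) refl
                                                 (σ i) (σ (n ∸ i)) (f i) (g (n ∸ i)) ⟩
  σ i * f i * (σ (n ∸ i) * g (n ∸ i))      ∎))
  where open ≡-Reasoning

deriv-reflect : ∀ f → deriv (reflect f) ≐ negPS (reflect (deriv f))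
deriv-reflect f n = trans (cong (λ s → ι (suc n) * (s * f (suc n))) (σ-suc n))
  (solve 3 (λ a s b → a :* ((:- s) :* b) := :- (s :* (a :* b))) refl (ι (suc n)) (σ n) (f (suc n)))

-- Urn families and the differential system x′ = y², y′ = x²

IsUrnFamily : (ℕ → ℕ → PS) → Set
IsUrnFamily F = ∀ i j → deriv (F i j) ≐ (scal (ι i) (F (i ∸ 1) (2 ℕ.+ j)) ⊕ scal (ι j) (F (2 ℕ.+ i) (j ∸ 1)))

urnFamily-unique : ∀ {F G} → IsUrnFamily F → IsUrnFamily G → (∀ i j → F i j 0 ≡ G i j 0) → ∀ i j → F i j ≐ G i j
urnFamily-unique rF rG F≡G i j zero    = F≡G i j
urnFamily-unique {F} {G} rF rG F≡G i j (suc n) = ι-cancel n (begin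
  ι (suc n) * F i j (suc n)                                          ≡⟨ rF i j n ⟩
  ι i * F (i ∸ 1) (2 ℕ.+ j) n + ι j * F (2 ℕ.+ i) (j ∸ 1) n
      ≡⟨ cong₂ (λ a b → ι i * a + ι j * b) (urnFamily-unique {F} {G} rF rG F≡G (i ∸ 1) (2 ℕ.+ j) n)
                                           (urnFamily-unique {F} {G} rF rG F≡G (2 ℕ.+ i) (j ∸ 1) n) ⟩
  ι i * G (i ∸ 1) (2 ℕ.+ j) n + ι j * G (2 ℕ.+ i) (j ∸ 1) n           ≡⟨ rG i j n ⟨
  ι (suc n) * G i j (suc n)                                          ∎)
  where open ≡-Reasoning

egf-urnCount-isUrnFamily : ∀ t → IsUrnFamily (λ i j → egf (λ n → urnCount t n i j))
egf-urnCount-isUrnFamily t i j = begin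
  deriv (egf (E i j))
      ≈⟨ deriv-egf (E i j) ⟩
  egf (λ n → i ℕ.* E (i ∸ 1) (2 ℕ.+ j) n ℕ.+ j ℕ.* E (2 ℕ.+ i) (j ∸ 1) n)
      ≈⟨ egf-+ (λ n → i ℕ.* E (i ∸ 1) (2 ℕ.+ j) n) (λ n → j ℕ.* E (2 ℕ.+ i) (j ∸ 1) n) ⟩
  egf (λ n → i ℕ.* E (i ∸ 1) (2 ℕ.+ j) n) ⊕ egf (λ n → j ℕ.* E (2 ℕ.+ i) (j ∸ 1) n)
      ≈⟨ ⊕-cong (egf-*ˡ i (E (i ∸ 1) (2 ℕ.+ j))) (egf-*ˡ j (E (2 ℕ.+ i) (j ∸ 1))) ⟩
  scal (ι i) (egf (E (i ∸ 1) (2 ℕ.+ j))) ⊕ scal (ι j) (egf (E (2 ℕ.+ i) (j ∸ 1)))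
      ∎
  where
  open ≐-Reasoning
  E : ℕ → ℕ → ℕ → ℕ
  E i j n = urnCount t n i j

UrnSystem : PS → PS → Set
UrnSystem a b = (deriv a ≐ (b ⊛ b)) × (deriv b ≐ (a ⊛ a))

powers-isUrnFamily : ∀ {a b} → UrnSystem a b → IsUrnFamily (λ i j → pow a i ⊛ pow b j)
powers-isUrnFamily {a} {b} (a′ , b′) i j = begin
  deriv (pow a i ⊛ pow b j)                                   ≈⟨ deriv-⊛ (pow a i) (pow b j) ⟩
  (deriv (pow a i) ⊛ pow b j) ⊕ (pow a i ⊛ deriv (pow b j))   ≈⟨ ⊕-cong (⊛-congˡ (pow b j) (deriv-pow a i)) (⊛-congʳ (pow a i) (deriv-pow b j)) ⟩
  ((natPS i ⊛ (pow a (i ∸ 1) ⊛ deriv a)) ⊛ pow b j) ⊕ (pow a i ⊛ (natPS j ⊛ (pow b (j ∸ 1) ⊛ deriv b)))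
      ≈⟨ ⊕-cong (⊛-congˡ (pow b j) (⊛-congʳ (natPS i) (⊛-congʳ (pow a (i ∸ 1)) a′)))
                (⊛-congʳ (pow a i) (⊛-congʳ (natPS j) (⊛-congʳ (pow b (j ∸ 1)) b′))) ⟩
  ((natPS i ⊛ (pow a (i ∸ 1) ⊛ (b ⊛ b))) ⊛ pow b j) ⊕ (pow a i ⊛ (natPS j ⊛ (pow b (j ∸ 1) ⊛ (a ⊛ a))))
      ≈⟨ PS-solve 8 (λ Ni Nj P Q a b Ai Bj →
              (Ni :*ₚ (P :*ₚ (b :*ₚ b))) :*ₚ Bj :+ₚ Ai :*ₚ (Nj :*ₚ (Q :*ₚ (a :*ₚ a)))
              :=ₚ Ni :*ₚ (P :*ₚ (b :*ₚ (b :*ₚ Bj))) :+ₚ Nj :*ₚ ((a :*ₚ (a :*ₚ Ai)) :*ₚ Q))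
           ≐-refl (natPS i) (natPS j) (pow a (i ∸ 1)) (pow b (j ∸ 1)) a b (pow a i) (pow b j) ⟩
  (natPS i ⊛ (pow a (i ∸ 1) ⊛ pow b (2 ℕ.+ j))) ⊕ (natPS j ⊛ (pow a (2 ℕ.+ i) ⊛ pow b (j ∸ 1)))
      ≈⟨ ⊕-cong (natPS-⊛ i _) (natPS-⊛ j _) ⟩
  scal (ι i) (pow a (i ∸ 1) ⊛ pow b (2 ℕ.+ j)) ⊕ scal (ι j) (pow a (2 ℕ.+ i) ⊛ pow b (j ∸ 1)) ∎
  where open ≐-Reasoning

pow-1-⊛-pow-0 : ∀ a b → (pow a 1 ⊛ pow b 0) ≐ a
pow-1-⊛-pow-0 a b = ≐-trans {pow a 1 ⊛ onePS} (⊛-identityʳ (a ⊛ onePS)) (⊛-identityʳ a)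

pow-0-⊛-pow-1 : ∀ a b → (pow a 0 ⊛ pow b 1) ≐ b
pow-0-⊛-pow-1 a b = ≐-trans {onePS ⊛ (b ⊛ onePS)} (⊛-identityˡ (b ⊛ onePS)) (⊛-identityʳ b)

urnSystem-unique : ∀ {a b c d} → UrnSystem a b → UrnSystem c d → a 0 ≡ c 0 → b 0 ≡ d 0 → (a ≐ c) × (b ≐ d)
urnSystem-unique {a} {b} {c} {d} ab cd a0 b0 =
    ≐-trans {a} (≐-sym (pow-1-⊛-pow-0 a b)) (≐-trans {pow a 1 ⊛ pow b 0} (powers≐ 1 0) (pow-1-⊛-pow-0 c d))
  , ≐-trans {b} (≐-sym (pow-0-⊛-pow-1 a b)) (≐-trans {pow a 0 ⊛ pow b 1} (powers≐ 0 1) (pow-0-⊛-pow-1 c d))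
  where
  powers≐ : ∀ i j → (pow a i ⊛ pow b j) ≐ (pow c i ⊛ pow d j)
  powers≐ = urnFamily-unique {λ i j → pow a i ⊛ pow b j} {λ i j → pow c i ⊛ pow d j} (powers-isUrnFamily ab) (powers-isUrnFamily cd)
              (λ i j → cong₂ _*_ (pow-constant-cong a c i a0) (pow-constant-cong b d j b0))

egf-urnCount≐ : ∀ {a b} t → UrnSystem a b → (∀ i j → ι (t i j) ≡ (pow a i ⊛ pow b j) 0) →
  egf (λ n → urnCount t n 1 0) ≐ a
egf-urnCount≐ {a} {b} t ab t≡ = ≐-trans {egf (λ n → urnCount t n 1 0)}
  (urnFamily-unique {λ i j → egf (λ n → urnCount t n i j)} {λ i j → pow a i ⊛ pow b j}
     (egf-urnCount-isUrnFamily t) (powers-isUrnFamily ab) t≡ 1 0) (pow-1-⊛-pow-0 a b)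

-- invUpTo f n has the coefficients of 1/f in degrees ≤ n and those of 1 above; inv f reads off its diagonal.
invUpTo : PS → ℕ → PS
invUpTo f zero    k = onePS k
invUpTo f (suc n) k with k ℕ.≟ suc n
... | yes _ = - sumTo n (λ i → f (suc i) * invUpTo f n (n ∸ i))
... | no _  = invUpTo f n k

inv : PS → PS
inv f k = invUpTo f k k

inv-suc : ∀ f n → inv f (suc n) ≡ - sumTo n (λ i → f (suc i) * invUpTo f n (n ∸ i))
inv-suc f n with suc n ℕ.≟ suc n
... | yes _ = refl
... | no ne = ⊥-elim (ne refl)

invUpTo-stable : ∀ f n k → k ℕ.≤ n → invUpTo f n k ≡ inv f k
invUpTo-stable f zero    zero _ = refl
invUpTo-stable f (suc n) k k≤ with k ℕ.≟ suc n
... | yes refl = sym (inv-suc f n)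
... | no ne    = invUpTo-stable f n k (ℕₚ.≤-pred (ℕₚ.≤∧≢⇒< k≤ ne))

⊛-inv : ∀ f → f 0 ≡ 1ℚ → (f ⊛ inv f) ≐ onePS
⊛-inv f f0 zero    = cong (_* 1ℚ) f0
⊛-inv f f0 (suc n) = begin
  (f ⊛ inv f) (suc n)          ≡⟨ ⊛-suc f (inv f) n ⟩
  f 0 * inv f (suc n) + rest   ≡⟨ cong₂ (λ a b → a * b + rest) f0 (trans (inv-suc f n) (cong -_ (sumTo-cong n
                                    (λ i _ → cong (f (suc i) *_) (invUpTo-stable f n (n ∸ i) (ℕₚ.m∸n≤m n i)))))) ⟩
  1ℚ * - rest + rest           ≡⟨ solve 1 (λ a → con 1ℚ :* (:- a) :+ a := con 0ℚ) refl rest ⟩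
  0ℚ                           ∎
  where
  open ≡-Reasoning
  rest : ℚ
  rest = (shift f ⊛ inv f) n

module DixonianFunctions {sm cm : PS} (isSmCm : IsSmCm sm cm) where

  private
    sm0 : sm 0 ≡ 0ℚ
    sm0 = proj₁ isSmCm
    cm0 : cm 0 ≡ 1ℚ
    cm0 = proj₁ (proj₂ isSmCm)
    sm′ : deriv sm ≐ (cm ⊛ cm)
    sm′ = proj₁ (proj₂ (proj₂ isSmCm))
    cm′ : deriv cm ≐ negPS (sm ⊛ sm)
    cm′ = proj₂ (proj₂ (proj₂ isSmCm))
    smh0 : smh sm 0 ≡ 0ℚ
    smh0 = cong (λ s → - (1ℚ * s)) sm0
    cmh0 : cmh cm 0 ≡ 1ℚ
    cmh0 = cong (1ℚ *_) cm0

  smh-cmh-urnSystem : UrnSystem (smh sm) (cmh cm)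
  smh-cmh-urnSystem = smh′ , cmh′
    where
    open ≐-Reasoning
    smh′ : deriv (smh sm) ≐ (cmh cm ⊛ cmh cm)
    smh′ = begin
      deriv (negPS (reflect sm))            ≈⟨ deriv-neg (reflect sm) ⟩
      negPS (deriv (reflect sm))            ≈⟨ negPS-cong (deriv-reflect sm) ⟩
      negPS (negPS (reflect (deriv sm)))    ≈⟨ negPS-involutive (reflect (deriv sm)) ⟩
      reflect (deriv sm)                    ≈⟨ reflect-cong sm′ ⟩
      reflect (cm ⊛ cm)                     ≈⟨ reflect-⊛ cm cm ⟩
      cmh cm ⊛ cmh cm                       ∎
    cmh′ : deriv (cmh cm) ≐ (smh sm ⊛ smh sm)
    cmh′ = begin
      deriv (reflect cm)                    ≈⟨ deriv-reflect cm ⟩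
      negPS (reflect (deriv cm))            ≈⟨ negPS-cong (reflect-cong cm′) ⟩
      negPS (reflect (negPS (sm ⊛ sm)))     ≈⟨ negPS-cong (reflect-neg (sm ⊛ sm)) ⟩
      negPS (negPS (reflect (sm ⊛ sm)))     ≈⟨ negPS-involutive (reflect (sm ⊛ sm)) ⟩
      reflect (sm ⊛ sm)                     ≈⟨ reflect-⊛ sm sm ⟩
      reflect sm ⊛ reflect sm               ≈⟨ neg-⊛-neg (reflect sm) (reflect sm) ⟨
      smh sm ⊛ smh sm                       ∎

  sm³+cm³≐1 : (pow sm 3 ⊕ pow cm 3) ≐ onePS
  sm³+cm³≐1 = deriv≐zero⇒≐onePS (pow sm 3 ⊕ pow cm 3) constant
    (cong₂ (λ s c → s * (s * (s * 1ℚ)) + c * (c * (c * 1ℚ))) sm0 cm0)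
    where
    open ≐-Reasoning
    three-cm²sm² : PS
    three-cm²sm² = natPS 3 ⊛ (pow cm 2 ⊛ (sm ⊛ sm))
    constant : deriv (pow sm 3 ⊕ pow cm 3) ≐ zeroPS
    constant = begin
      deriv (pow sm 3 ⊕ pow cm 3)                                               ≈⟨ deriv-⊕ (pow sm 3) (pow cm 3) ⟩
      deriv (pow sm 3) ⊕ deriv (pow cm 3)                                       ≈⟨ ⊕-cong (deriv-pow sm 3) (deriv-pow cm 3) ⟩
      (natPS 3 ⊛ (pow sm 2 ⊛ deriv sm)) ⊕ (natPS 3 ⊛ (pow cm 2 ⊛ deriv cm))
          ≈⟨ ⊕-cong (⊛-congʳ (natPS 3) (⊛-congʳ (pow sm 2) sm′)) (⊛-congʳ (natPS 3) (⊛-congʳ (pow cm 2) cm′)) ⟩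
      (natPS 3 ⊛ (pow sm 2 ⊛ (cm ⊛ cm))) ⊕ (natPS 3 ⊛ (pow cm 2 ⊛ negPS (sm ⊛ sm)))
          ≈⟨ ⊕-cong (PS-solve 3 (λ N s c → N :*ₚ ((s :*ₚ (s :*ₚ conₚ 1)) :*ₚ (c :*ₚ c)) :=ₚ N :*ₚ ((c :*ₚ (c :*ₚ conₚ 1)) :*ₚ (s :*ₚ s)))
                                ≐-refl (natPS 3) sm cm)
                    (≐-trans {natPS 3 ⊛ (pow cm 2 ⊛ negPS (sm ⊛ sm))}
                       (⊛-congʳ (natPS 3) (⊛-negʳ (pow cm 2) (sm ⊛ sm))) (⊛-negʳ (natPS 3) (pow cm 2 ⊛ (sm ⊛ sm)))) ⟩
      three-cm²sm² ⊕ negPS three-cm²sm²                                         ≈⟨ (λ n → +-inverseʳ (three-cm²sm² n)) ⟩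
      zeroPS                                                                    ∎

  private
    I : PS
    I = inv cm
    cm⊛I≐1 : (cm ⊛ I) ≐ onePS
    cm⊛I≐1 = ⊛-inv cm cm0

    cm⊛I′≐sm²⊛I : (cm ⊛ deriv I) ≐ ((sm ⊛ sm) ⊛ I)
    cm⊛I′≐sm²⊛I = neg-⊕≐zero⇒≐ (begin
      negPS ((sm ⊛ sm) ⊛ I) ⊕ (cm ⊛ deriv I)
          ≈⟨ ⊕-cong (≐-trans {negPS ((sm ⊛ sm) ⊛ I)} (negPS-cong (⊛-comm (sm ⊛ sm) I))
                       (≐-trans {negPS (I ⊛ (sm ⊛ sm))} (≐-sym (⊛-negʳ I (sm ⊛ sm))) (⊛-comm I (negPS (sm ⊛ sm)))))
                    (≐-refl {cm ⊛ deriv I}) ⟩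
      (negPS (sm ⊛ sm) ⊛ I) ⊕ (cm ⊛ deriv I)   ≈⟨ ⊕-cong (⊛-congˡ I cm′) (≐-refl {cm ⊛ deriv I}) ⟨
      (deriv cm ⊛ I) ⊕ (cm ⊛ deriv I)          ≈⟨ deriv-⊛ cm I ⟨
      deriv (cm ⊛ I)                           ≈⟨ deriv-cong cm⊛I≐1 ⟩
      deriv onePS                              ≈⟨ deriv-onePS ⟩
      zeroPS                                   ∎)
      where open ≐-Reasoning

  sm/cm-urnSystem : UrnSystem (sm ⊛ inv cm) (inv cm)
  sm/cm-urnSystem = A′ , B′
    where
    open ≐-Reasoning
    B′ : deriv I ≐ ((sm ⊛ I) ⊛ (sm ⊛ I))
    B′ = begin
      deriv I                          ≈⟨ ⊛-identityˡ (deriv I) ⟨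
      onePS ⊛ deriv I                  ≈⟨ ⊛-congˡ (deriv I) cm⊛I≐1 ⟨
      (cm ⊛ I) ⊛ deriv I               ≈⟨ PS-solve 3 (λ c i d → (c :*ₚ i) :*ₚ d :=ₚ i :*ₚ (c :*ₚ d)) ≐-refl cm I (deriv I) ⟩
      I ⊛ (cm ⊛ deriv I)               ≈⟨ ⊛-congʳ I cm⊛I′≐sm²⊛I ⟩
      I ⊛ ((sm ⊛ sm) ⊛ I)              ≈⟨ PS-solve 2 (λ i s → i :*ₚ ((s :*ₚ s) :*ₚ i) :=ₚ (s :*ₚ i) :*ₚ (s :*ₚ i)) ≐-refl I sm ⟩
      (sm ⊛ I) ⊛ (sm ⊛ I)              ∎
    A′ : deriv (sm ⊛ I) ≐ (I ⊛ I)
    A′ = begin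
      deriv (sm ⊛ I)                                         ≈⟨ deriv-⊛ sm I ⟩
      (deriv sm ⊛ I) ⊕ (sm ⊛ deriv I)                        ≈⟨ ⊕-cong (⊛-congˡ I sm′) (⊛-congʳ sm B′) ⟩
      ((cm ⊛ cm) ⊛ I) ⊕ (sm ⊛ ((sm ⊛ I) ⊛ (sm ⊛ I)))
          ≈⟨ ⊕-cong (≐-trans {(cm ⊛ cm) ⊛ I} (≐-sym (⊛-identityʳ ((cm ⊛ cm) ⊛ I))) (⊛-congʳ ((cm ⊛ cm) ⊛ I) (≐-sym cm⊛I≐1)))
                    (≐-refl {sm ⊛ ((sm ⊛ I) ⊛ (sm ⊛ I))}) ⟩
      (((cm ⊛ cm) ⊛ I) ⊛ (cm ⊛ I)) ⊕ (sm ⊛ ((sm ⊛ I) ⊛ (sm ⊛ I)))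
          ≈⟨ PS-solve 3 (λ c i s → ((c :*ₚ c) :*ₚ i) :*ₚ (c :*ₚ i) :+ₚ s :*ₚ ((s :*ₚ i) :*ₚ (s :*ₚ i))
                          :=ₚ (i :*ₚ i) :*ₚ (s :*ₚ (s :*ₚ (s :*ₚ conₚ 1)) :+ₚ c :*ₚ (c :*ₚ (c :*ₚ conₚ 1)))) ≐-refl cm I sm ⟩
      (I ⊛ I) ⊛ (pow sm 3 ⊕ pow cm 3)                        ≈⟨ ⊛-congʳ (I ⊛ I) sm³+cm³≐1 ⟩
      (I ⊛ I) ⊛ onePS                                        ≈⟨ ⊛-identityʳ (I ⊛ I) ⟩
      I ⊛ I                                                  ∎

  private
    sm/cm≐smh×1/cm≐cmh : ((sm ⊛ inv cm) ≐ smh sm) × (inv cm ≐ cmh cm)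
    sm/cm≐smh×1/cm≐cmh = urnSystem-unique sm/cm-urnSystem smh-cmh-urnSystem
      (trans (cong (_* inv cm 0) sm0) (trans (*-zeroˡ (inv cm 0)) (sym smh0))) (sym cmh0)

  smh⊛cm≐sm : (smh sm ⊛ cm) ≐ sm
  smh⊛cm≐sm = begin
    smh sm ⊛ cm            ≈⟨ ⊛-congˡ cm (proj₁ sm/cm≐smh×1/cm≐cmh) ⟨
    (sm ⊛ inv cm) ⊛ cm     ≈⟨ PS-solve 3 (λ s i c → (s :*ₚ i) :*ₚ c :=ₚ s :*ₚ (c :*ₚ i)) ≐-refl sm (inv cm) cm ⟩
    sm ⊛ (cm ⊛ inv cm)     ≈⟨ ⊛-congʳ sm cm⊛I≐1 ⟩
    sm ⊛ onePS             ≈⟨ ⊛-identityʳ sm ⟩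
    sm                     ∎
    where open ≐-Reasoning

  cmh⊛cm≐1 : (cmh cm ⊛ cm) ≐ onePS
  cmh⊛cm≐1 = begin
    cmh cm ⊛ cm            ≈⟨ ⊛-congˡ cm (proj₂ sm/cm≐smh×1/cm≐cmh) ⟨
    inv cm ⊛ cm            ≈⟨ ⊛-comm (inv cm) cm ⟩
    cm ⊛ inv cm            ≈⟨ cm⊛I≐1 ⟩
    onePS                  ∎
    where open ≐-Reasoning

  egf-H0≐smh : egf (λ n → H n 0) ≐ smh sm
  egf-H0≐smh = begin
    egf (λ n → H n 0)                     ≈⟨ egf-cong {λ n → H n 0} {λ n → urnCount (hasX 0) n 1 0} (λ n → H≡urnCount n 0) ⟩
    egf (λ n → urnCount (hasX 0) n 1 0)   ≈⟨ egf-urnCount≐ (hasX 0) smh-cmh-urnSystem initial ⟩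
    smh sm                                ∎
    where
    open ≐-Reasoning
    initial : ∀ i j → ι (hasX 0 i j) ≡ (pow (smh sm) i ⊛ pow (cmh cm) j) 0
    initial zero    j = sym (trans (*-identityˡ (pow (cmh cm) j 0)) (pow-constant-one (cmh cm) j cmh0))
    initial (suc i) j = sym (trans (cong (_* pow (cmh cm) j 0) (pow-constant-zero (smh sm) i smh0)) (*-zeroˡ (pow (cmh cm) j 0)))

  egf-Htop≐cmh : egf (λ n → H n (suc n)) ≐ cmh cm
  egf-Htop≐cmh = begin
    egf (λ n → H n (suc n))               ≈⟨ egf-cong {λ n → H n (suc n)} {λ n → urnCount noY n 1 0} H-top≡urnCount ⟩
    egf (λ n → urnCount noY n 1 0)        ≈⟨ egf-urnCount≐ noY (proj₂ smh-cmh-urnSystem , proj₁ smh-cmh-urnSystem) initial ⟩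
    cmh cm                                ∎
    where
    open ≐-Reasoning
    initial : ∀ i j → ι (noY i j) ≡ (pow (cmh cm) i ⊛ pow (smh sm) j) 0
    initial i zero    = sym (trans (*-identityʳ (pow (cmh cm) i 0)) (pow-constant-one (cmh cm) i cmh0))
    initial i (suc j) = sym (trans (cong (pow (cmh cm) i 0 *_) (pow-constant-zero (smh sm) j smh0)) (*-zeroʳ (pow (cmh cm) i 0)))

mainTheorem3 : (sm cm : PS) → IsSmCm sm cm →
    (egf (λ n → H n 0) ≐ smh sm) × ((smh sm ⊛ cm) ≐ sm) × (smh sm ≐ negPS (reflect sm))
  × (egf (λ n → H n (suc n)) ≐ cmh cm) × ((cmh cm ⊛ cm) ≐ onePS) × (cmh cm ≐ reflect cm)
mainTheorem3 sm cm isSmCm = egf-H0≐smh , smh⊛cm≐sm , ≐-refl , egf-Htop≐cmh , cmh⊛cm≐1 , ≐-refl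
  where open DixonianFunctions {sm} {cm} isSmCm
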